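{- Let $G$ be a connected graph with $c(G) > 3$ and $u \in V(G)$ such that $G - N[u] \simeq \mathcal{P}_i$ for some $0 \leq i \leq 6$, with $m, m', B_u$ and the projection multiplicity $p$ as described in the context. Then for every $x \in B_u$, $|N(x)\cap N(u)| \geq \sum_{y \in N[x]\cap B_u} p(y)$. In particular, if $y \in B_u$ has projection multiplicity $k$, then each vertex of $N(y)\cap B_u$ has at least $k$ neighbours in $N(u)$.
   Context: Graphs are finite, simple, undirected; $N(v)$, $N[v]=N(v)\cup\{v\}$ are open/closed neighbourhoods in $G$, $G-S$ deletes the vertex set $S$, $\langle S\rangle$ is the induced subgraph. Cop number $c(G)$: minimum number of cops that can guarantee capture in the game where cops first choose start vertices (sharing allowed), then the robber, then they alternate (cops first), each piece staying or moving to an adjacent vertex, with full information. The Petersen graph $\mathcal{P}_0$ has vertices $\alpha_1,\dots,\alpha_5,\beta_1,\dots,\beta_5$ and edges $\alpha_j\alpha_{j+1}$ (mod 5), $\alpha_j\beta_j$, $\beta_1\beta_3,\beta_1\beta_4,\beta_2\beta_4,\beta_2\beta_5,\beta_3\beta_5$; its vertex $m'=\alpha_1$. For $1\le i\le 6$, $\mathcal{P}_i$ is $\mathcal{P}_0$ plus a new vertex $m$ with neighbourhood $\{\alpha_1\}$ ($i=1$), $\{\alpha_1,\beta_1\}$ ($i=2$), $\{\alpha_2,\alpha_5\}$ ($i=3$), $\{\alpha_1,\alpha_2,\alpha_5\}$ ($i=4$), $\{\beta_1,\alpha_2,\alpha_5\}$ ($i=5$), $\{\alpha_1,\beta_1,\alpha_2,\alpha_5\}$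 ($i=6$). When $i \geq 1$, fix an isomorphism $G - N[u]\to\mathcal{P}_i$ and denote also by $m, m'$ the vertices of $G$ mapped to $m,m'$; when $i \in \{5,6\}$, choose the labels so that $d_G(m') \geq d_G(m)$. Let $B_u = V(G - N[u]) \setminus \{m\}$ (for $i=0$, $B_u = V(G-N[u])$); so $\langle B_u\rangle$ is a Petersen graph. For $w \in N(u)$ with $|N(w)\cap B_u| = 4$ and $N(w)\cap B_u = N[x]\cap B_u$ for some $x\in B_u$, the vertex $x$ is called the projection of $w$; the projection multiplicity $p(x)$ of $x \in B_u$ is the number of vertices $w \in N(u)$ whose projection is $x$. -}

module Defs where

open import Data.Nat using (ℕ; zero; suc; _+_; _≤_)
import Data.Nat as ℕ
open import Data.Fin using (Fin; toℕ; fromℕ)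
import Data.Fin as F
open import Data.Bool using (Bool; true; false; _∧_; _∨_; not; if_then_else_; _xor_)
open import Data.List using (List; []; _∷_; _++_; map)
open import Data.Bool.ListAction using (any)
open import Data.Product using (Σ; ∃; _×_; _,_)
open import Data.Sum using (_⊎_)
open import Data.Maybe using (Maybe; just; nothing)
open import Relation.Nullary using (¬_)
open import Relation.Nullary.Decidable using (⌊_⌋)
open import Relation.Binary.PropositionalEquality using (_≡_; _≢_)

record Graph : Set where
  field
    n      : ℕ
    adj    : Fin n → Fin n → Bool
    sym    : ∀ a b → adj a b ≡ adj b a
    irrefl : ∀ a → adj a a ≡ false

Vertex : Graph → Set
Vertex G = Fin (Graph.n G)

count : ∀ {n} → (Fin n → Bool) → ℕ
count {zero}  f = 0
count {suc n} f = (if f F.zero then 1 else 0) + count (λ v → f (F.suc v))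

sumFin : ∀ {n} → (Fin n → ℕ) → ℕ
sumFin {zero}  f = 0
sumFin {suc n} f = f F.zero + sumFin (λ v → f (F.suc v))

allFin : ∀ {n} → (Fin n → Bool) → Bool
allFin {zero}  f = true
allFin {suc n} f = f F.zero ∧ allFin (λ v → f (F.suc v))

eqFin : ∀ {n} → Fin n → Fin n → Bool
eqFin a b = ⌊ a F.≟ b ⌋

module _ (G : Graph) where
  open Graph G

  degree : Vertex G → ℕ
  degree v = count (adj v)

  closedAdj : Vertex G → Vertex G → Bool
  closedAdj x v = eqFin x v ∨ adj x v

  data Reach : Vertex G → Vertex G → Set where
    here : ∀ {a} → Reach a a
    step : ∀ {a b c} → adj a b ≡ true → Reach b c → Reach a c

  Connected : Set
  Connected = ∀ a b → Reach a b

  -- A position with the cops to move is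
  -- given by the cop placement c and the robber position r.
  -- CopsWin c r : the cops can force capture (in finitely many rounds)
  -- from this position.

  Captured : ∀ {k} → (Fin k → Vertex G) → Vertex G → Set
  Captured c r = ∃ λ i → c i ≡ r

  Move : Vertex G → Vertex G → Set
  Move a b = a ≡ b ⊎ adj a b ≡ true

  data CopsWin {k : ℕ} : (Fin k → Vertex G) → Vertex G → Set where
    win : ∀ {c r} (c' : Fin k → Vertex G) →
          (∀ i → Move (c i) (c' i)) →
          (Captured c' r ⊎
            (∀ r' → Move r r' → Captured c' r' ⊎ CopsWin c' r')) →
          CopsWin c r

  -- k cops have a winning strategy: they choose starting vertices
  -- (sharing allowed), then for every robber start the cops (moving
  -- first) can force capture.
  CopsCanWin : ℕ → Set
  CopsCanWin k = Σ (Fin k → Vertex G) λ c → ∀ r → Captured c r ⊎ CopsWin c r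

  CopNumberGreaterThan : ℕ → Set
  CopNumberGreaterThan k = ¬ CopsCanWin k

-- The graphs P_0, ..., P_6.
-- Labels: α_j ↦ j-1 (0..4), β_j ↦ 4+j (5..9), m ↦ 10.

petersenEdges : List (ℕ × ℕ)
petersenEdges =
  (0 , 1) ∷ (1 , 2) ∷ (2 , 3) ∷ (3 , 4) ∷ (4 , 0) ∷
  (0 , 5) ∷ (1 , 6) ∷ (2 , 7) ∷ (3 , 8) ∷ (4 , 9) ∷
  (5 , 7) ∷ (5 , 8) ∷ (6 , 8) ∷ (6 , 9) ∷ (7 , 9) ∷ []

mNbrs : Fin 7 → List ℕ
mNbrs F.zero = []
mNbrs (F.suc F.zero) = 0 ∷ []
mNbrs (F.suc (F.suc F.zero)) = 0 ∷ 5 ∷ []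
mNbrs (F.suc (F.suc (F.suc F.zero))) = 1 ∷ 4 ∷ []
mNbrs (F.suc (F.suc (F.suc (F.suc F.zero)))) = 0 ∷ 1 ∷ 4 ∷ []
mNbrs (F.suc (F.suc (F.suc (F.suc (F.suc F.zero))))) = 5 ∷ 1 ∷ 4 ∷ []
mNbrs (F.suc (F.suc (F.suc (F.suc (F.suc (F.suc F.zero)))))) = 0 ∷ 5 ∷ 1 ∷ 4 ∷ []

edgesP : Fin 7 → List (ℕ × ℕ)
edgesP i = petersenEdges ++ map (λ v → (10 , v)) (mNbrs i)

eqℕ : ℕ → ℕ → Bool
eqℕ a b = ⌊ a ℕ.≟ b ⌋

adjℕ : Fin 7 → ℕ → ℕ → Bool
adjℕ i a b = any (λ { (x , y) → (eqℕ x a ∧ eqℕ y b) ∨ (eqℕ x b ∧ eqℕ y a) }) (edgesP i)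

sizeP : Fin 7 → ℕ
sizeP F.zero    = 10
sizeP (F.suc _) = 11

adjP : (i : Fin 7) → Fin (sizeP i) → Fin (sizeP i) → Bool
adjP i a b = adjℕ i (toℕ a) (toℕ b)

mIdx : (i : Fin 7) → Maybe (Fin (sizeP i))
mIdx F.zero    = nothing
mIdx (F.suc _) = just (fromℕ 10)

-- the vertex m' = α_1 of P_i
m'Idx : (i : Fin 7) → Fin (sizeP i)
m'Idx F.zero    = F.zero
m'Idx (F.suc _) = F.zero

-- An isomorphism G - N[u] → P_i, given by its inverse f : V(P_i) → V(G)

module _ (G : Graph) where
  open Graph G

  outside : Vertex G → Vertex G → Bool
  outside u v = not (closedAdj G u v)

  record PIso (u : Vertex G) (i : Fin 7) : Set where
    field
      f     : Fin (sizeP i) → Vertex G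
      inj   : ∀ a b → f a ≡ f b → a ≡ b
      into  : ∀ a → outside u (f a) ≡ true
      onto  : ∀ v → outside u v ≡ true → ∃ λ a → f a ≡ v
      edges : ∀ a b → adj (f a) (f b) ≡ adjP i a b

  module _ {u : Vertex G} {i : Fin 7} (φ : PIso u i) where
    open PIso φ

    -- labelling convention: for i ∈ {5,6}, d_G(m') ≥ d_G(m)
    DegreeConvention : Set
    DegreeConvention = ∀ j → mIdx i ≡ just j → 5 ≤ toℕ i →
                       degree G (f j) ≤ degree G (f (m'Idx i))

    isM : Vertex G → Bool
    isM v with mIdx i
    ... | nothing = false
    ... | just j  = eqFin (f j) v

    inB : Vertex G → Bool
    inB v = outside u v ∧ not (isM v)

    isProjectionOf : Vertex G → Vertex G → Bool
    isProjectionOf w x =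
      adj u w ∧ inB x ∧
      eqℕ (count (λ v → adj w v ∧ inB v)) 4 ∧
      allFin (λ v → not ((adj w v ∧ inB v) xor (closedAdj G x v ∧ inB v)))

    projMult : Vertex G → ℕ
    projMult x = count (λ w → isProjectionOf w x)

    projSum : Vertex G → ℕ
    projSum x = sumFin (λ y → if closedAdj G x y ∧ inB y then projMult y else 0)

  commonNbrs : Vertex G → Vertex G → ℕ
  commonNbrs u x = count (λ w → adj x w ∧ adj u w)

module Submission where

-- Idea of the proof (a double count).  Fix x ∈ B_u.  Every w ∈ N(u) has at
-- most one projection: a projection y of w is pinned down by the trace
-- N[y] ∩ B_u = N(w) ∩ B_u, and in each graph P_i distinct vertices other
-- than m have distinct closed neighbourhoods within P_i - m (a finite check).
-- Moreover, if w projects to some y ∈ N[x] ∩ B_u, then x ∈ N[y] ∩ B_u = N(w) ∩ B_u,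
-- so w ∈ N(x) ∩ N(u).  Counting the pairs (y, w) with y ∈ N[x] ∩ B_u and
-- w projecting to y by y gives Σ_{y ∈ N[x] ∩ B_u} p(y), and by w gives at most
-- |N(x) ∩ N(u)|.  The second claim is the special case of one summand.
-- (Connectedness, c(G) > 3 and the degree convention are not needed.)

open import Defs
open import Data.Nat using (ℕ; zero; suc; _+_; _≤_; z≤n; s≤s)
open import Data.Nat.Properties
  using (≤-trans; +-mono-≤; m≤m+n; m≤n+m; +-commutativeSemigroup; module ≤-Reasoning)
open import Algebra.Properties.CommutativeSemigroup +-commutativeSemigroup using (interchange)
open import Data.Fin using (Fin; fromℕ)
import Data.Fin as F
open import Data.Fin.Properties using (suc-injective)
open import Data.Bool using (Bool; true; false; _∧_; _∨_; not; if_then_else_; _xor_)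
open import Data.Bool.Properties using (∧-conicalˡ; ∧-conicalʳ; ∨-zeroʳ; xor-same; if-cong; T-≡)
open import Data.Product using (_×_; _,_)
open import Function.Bundles using (_⇔_; mk⇔; Equivalence)
open import Relation.Nullary using (Dec; contradiction)
open import Relation.Nullary.Decidable using (⌊_⌋; toWitness; does-⇔; isYes≗does)
open import Relation.Binary.PropositionalEquality using (_≡_; refl; sym; trans; cong; cong₂; module ≡-Reasoning)

_⇒ᵇ_ : Bool → Bool → Bool
p ⇒ᵇ q = not p ∨ q

modus-ponens : ∀ {p q} → (p ⇒ᵇ q) ≡ true → p ≡ true → q ≡ true
modus-ponens imp refl = imp

xnor-sound : ∀ {p q} → not (p xor q) ≡ true → p ≡ q
xnor-sound {true}  {true}  _ = refl
xnor-sound {false} {false} _ = refl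

xnor-complete : ∀ {p q} → p ≡ q → not (p xor q) ≡ true
xnor-complete {p} refl = cong not (xor-same p)

eqFin-sound : ∀ {n} {a b : Fin n} → eqFin a b ≡ true → a ≡ b
eqFin-sound {a = a} {b} p = toWitness {a? = a F.≟ b} (Equivalence.from T-≡ p)

decide-⇔ : ∀ {A B : Set} → A ⇔ B → (a? : Dec A) (b? : Dec B) → ⌊ a? ⌋ ≡ ⌊ b? ⌋
decide-⇔ A⇔B a? b? = trans (isYes≗does a?) (trans (does-⇔ A⇔B a? b?) (sym (isYes≗does b?)))

eqFin-sym : ∀ {n} (a b : Fin n) → eqFin a b ≡ eqFin b a
eqFin-sym a b = decide-⇔ (mk⇔ sym sym) (a F.≟ b) (b F.≟ a)

eqFin-injective : ∀ {n m} (f : Fin n → Fin m) → (∀ a b → f a ≡ f b → a ≡ b) →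
                  ∀ a b → eqFin (f a) (f b) ≡ eqFin a b
eqFin-injective f inj a b = decide-⇔ (mk⇔ (inj a b) (cong f)) (f a F.≟ f b) (a F.≟ b)

∧-trueˡ : ∀ {a b} → (a ∧ b) ≡ true → a ≡ true
∧-trueˡ {a} {b} = ∧-conicalˡ a b

∧-trueʳ : ∀ {a b} → (a ∧ b) ≡ true → b ≡ true
∧-trueʳ {a} {b} = ∧-conicalʳ a b

allFin-sound : ∀ {n} (f : Fin n → Bool) → allFin f ≡ true → ∀ v → f v ≡ true
allFin-sound {suc n} f p F.zero    = ∧-trueˡ p
allFin-sound {suc n} f p (F.suc v) = allFin-sound (λ v → f (F.suc v)) (∧-trueʳ p) v

allFin-complete : ∀ {n} (f : Fin n → Bool) → (∀ v → f v ≡ true) → allFin f ≡ true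
allFin-complete {zero}  f p = refl
allFin-complete {suc n} f p = cong₂ _∧_ (p F.zero) (allFin-complete (λ v → f (F.suc v)) (λ v → p (F.suc v)))

ind : Bool → ℕ
ind b = if b then 1 else 0

count-as-sum : ∀ {n} (f : Fin n → Bool) → count f ≡ sumFin (λ v → ind (f v))
count-as-sum {zero}  f = refl
count-as-sum {suc n} f = cong (ind (f F.zero) +_) (count-as-sum (λ v → f (F.suc v)))

sum-zero : ∀ n → sumFin {n} (λ _ → 0) ≡ 0
sum-zero zero    = refl
sum-zero (suc n) = sum-zero n

guarded-count : ∀ {n} (b : Bool) (f : Fin n → Bool) →
                (if b then count f else 0) ≡ sumFin (λ w → ind (b ∧ f w))
guarded-count true  f = count-as-sum f
guarded-count {n} false f = sym (sum-zero n)

sum-cong : ∀ {n} {f g : Fin n → ℕ} → (∀ v → f v ≡ g v) → sumFin f ≡ sumFin g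
sum-cong {zero}  h = refl
sum-cong {suc n} h = cong₂ _+_ (h F.zero) (sum-cong (λ v → h (F.suc v)))

sum-mono : ∀ {n} {f g : Fin n → ℕ} → (∀ v → f v ≤ g v) → sumFin f ≤ sumFin g
sum-mono {zero}  h = z≤n
sum-mono {suc n} h = +-mono-≤ (h F.zero) (sum-mono (λ v → h (F.suc v)))

sum-+ : ∀ {n} (f g : Fin n → ℕ) → sumFin (λ v → f v + g v) ≡ sumFin f + sumFin g
sum-+ {zero}  f g = refl
sum-+ {suc n} f g = begin
  f F.zero + g F.zero + sumFin (λ v → f (F.suc v) + g (F.suc v))
    ≡⟨ cong (f F.zero + g F.zero +_) (sum-+ (λ v → f (F.suc v)) (λ v → g (F.suc v))) ⟩
  f F.zero + g F.zero + (sumFin (λ v → f (F.suc v)) + sumFin (λ v → g (F.suc v)))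
    ≡⟨ interchange (f F.zero) (g F.zero) _ _ ⟩
  f F.zero + sumFin (λ v → f (F.suc v)) + (g F.zero + sumFin (λ v → g (F.suc v))) ∎
  where open ≡-Reasoning

sum-swap : ∀ {n m} (g : Fin n → Fin m → ℕ) →
           sumFin (λ y → sumFin (λ w → g y w)) ≡ sumFin (λ w → sumFin (λ y → g y w))
sum-swap {zero} {m} g = sym (sum-zero m)
sum-swap {suc n} g = begin
  sumFin (g F.zero) + sumFin (λ y → sumFin (g (F.suc y)))
    ≡⟨ cong (sumFin (g F.zero) +_) (sum-swap (λ y → g (F.suc y))) ⟩
  sumFin (g F.zero) + sumFin (λ w → sumFin (λ y → g (F.suc y) w))
    ≡⟨ sym (sum-+ (g F.zero) (λ w → sumFin (λ y → g (F.suc y) w))) ⟩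
  sumFin (λ w → g F.zero w + sumFin (λ y → g (F.suc y) w)) ∎
  where open ≡-Reasoning

term≤sum : ∀ {n} (f : Fin n → ℕ) y → f y ≤ sumFin f
term≤sum f F.zero    = m≤m+n _ _
term≤sum f (F.suc y) = ≤-trans (term≤sum (λ v → f (F.suc v)) y) (m≤n+m _ _)

indicator-sum≤ : ∀ {n} (h : Fin n → Bool) (b : Bool) →
                 (∀ y y' → h y ≡ true → h y' ≡ true → y ≡ y') →
                 (∀ y → h y ≡ true → b ≡ true) →
                 sumFin (λ y → ind (h y)) ≤ ind b
indicator-sum≤ {zero} h b unique imp = z≤n
indicator-sum≤ {suc n} h b unique imp with h F.zero in h₀
... | false = indicator-sum≤ (λ y → h (F.suc y)) b
                (λ y y' p q → suc-injective (unique (F.suc y) (F.suc y') p q))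
                (λ y → imp (F.suc y))
... | true rewrite imp F.zero h₀ = s≤s (indicator-sum≤ (λ y → h (F.suc y)) false
                (λ y y' p q → suc-injective (unique (F.suc y) (F.suc y') p q))
                (λ y hy → contradiction (unique F.zero (F.suc y) h₀ hy) λ ()))

double-count : ∀ {m n} (S : Fin n → Bool) (R : Fin m → Fin n → Bool) (Q : Fin m → Bool) →
               (∀ w y y' → (S y ∧ R w y) ≡ true → (S y' ∧ R w y') ≡ true → y ≡ y') →
               (∀ w y → (S y ∧ R w y) ≡ true → Q w ≡ true) →
               sumFin (λ y → if S y then count (λ w → R w y) else 0) ≤ count Q
double-count S R Q unique imp = begin
  sumFin (λ y → if S y then count (λ w → R w y) else 0)
    ≡⟨ sum-cong (λ y → guarded-count (S y) (λ w → R w y)) ⟩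
  sumFin (λ y → sumFin (λ w → ind (S y ∧ R w y)))
    ≡⟨ sum-swap (λ y w → ind (S y ∧ R w y)) ⟩
  sumFin (λ w → sumFin (λ y → ind (S y ∧ R w y)))
    ≤⟨ sum-mono (λ w → indicator-sum≤ _ (Q w) (unique w) (imp w)) ⟩
  sumFin (λ w → ind (Q w))
    ≡⟨ sym (count-as-sum Q) ⟩
  count Q ∎
  where open ≤-Reasoning

isMP : (i : Fin 7) → Fin (sizeP i) → Bool
isMP F.zero    a = false
isMP (F.suc _) a = eqFin (fromℕ 10) a

closedAdjP : (i : Fin 7) → Fin (sizeP i) → Fin (sizeP i) → Bool
closedAdjP i a c = eqFin a c ∨ adjP i a c

traceP : (i : Fin 7) → Fin (sizeP i) → Fin (sizeP i) → Bool
traceP i a c = closedAdjP i a c ∧ not (isMP i c)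

sameTraceP : (i : Fin 7) → Fin (sizeP i) → Fin (sizeP i) → Bool
sameTraceP i a b = allFin (λ c → not (traceP i a c xor traceP i b c))

tracesSeparate : Fin 7 → Bool
tracesSeparate i = allFin λ a → allFin λ b →
  (not (isMP i a) ∧ not (isMP i b) ∧ sameTraceP i a b) ⇒ᵇ eqFin a b

tracesSeparate-holds : ∀ i → tracesSeparate i ≡ true
tracesSeparate-holds F.zero                                             = refl
tracesSeparate-holds (F.suc F.zero)                                     = refl
tracesSeparate-holds (F.suc (F.suc F.zero))                             = refl
tracesSeparate-holds (F.suc (F.suc (F.suc F.zero)))                     = refl
tracesSeparate-holds (F.suc (F.suc (F.suc (F.suc F.zero))))             = refl
tracesSeparate-holds (F.suc (F.suc (F.suc (F.suc (F.suc F.zero)))))     = refl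
tracesSeparate-holds (F.suc (F.suc (F.suc (F.suc (F.suc (F.suc F.zero)))))) = refl

traceP-separates : ∀ i a b → not (isMP i a) ≡ true → not (isMP i b) ≡ true →
                   (∀ c → traceP i a c ≡ traceP i b c) → a ≡ b
traceP-separates i a b a≠m b≠m same = eqFin-sound (modus-ponens
  (allFin-sound _ (allFin-sound _ (tracesSeparate-holds i) a) b)
  (cong₂ _∧_ a≠m (cong₂ _∧_ b≠m
    (allFin-complete _ (λ c → xnor-complete (same c))))))

isM-image : (G : Graph) {u : Vertex G} (i : Fin 7) (φ : PIso G u i) →
            ∀ c → isM G φ (PIso.f φ c) ≡ isMP i c
isM-image G F.zero    φ c = refl
isM-image G (F.suc _) φ c = eqFin-injective (PIso.f φ) (PIso.inj φ) (fromℕ 10) c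

inB-image : (G : Graph) {u : Vertex G} (i : Fin 7) (φ : PIso G u i) →
            ∀ c → inB G φ (PIso.f φ c) ≡ not (isMP i c)
inB-image G i φ c = cong₂ _∧_ (PIso.into φ c) (cong not (isM-image G i φ c))

closedAdj-sym : (G : Graph) (x y : Vertex G) → closedAdj G x y ≡ closedAdj G y x
closedAdj-sym G x y = cong₂ _∨_ (eqFin-sym x y) (Graph.sym G x y)

module _ (G : Graph) {u : Vertex G} {i : Fin 7} (φ : PIso G u i) where
  open Graph G using (adj)
  open PIso φ

  B : Vertex G → Bool
  B = inB G φ

  trace : Vertex G → Vertex G → Bool
  trace x v = closedAdj G x v ∧ B v

  trace-image : ∀ a c → trace (f a) (f c) ≡ traceP i a c
  trace-image a c =
    cong₂ _∧_ (cong₂ _∨_ (eqFin-injective f inj a c) (edges a c)) (inB-image G i φ c)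

  B-separated : ∀ x y → B x ≡ true → B y ≡ true → (∀ v → trace x v ≡ trace y v) → x ≡ y
  B-separated x y x∈B y∈B same with onto x (∧-trueˡ x∈B) | onto y (∧-trueˡ y∈B)
  ... | a , refl | b , refl = cong f (traceP-separates i a b
    (trans (sym (inB-image G i φ a)) x∈B)
    (trans (sym (inB-image G i φ b)) y∈B)
    (λ c → trans (sym (trace-image a c)) (trans (same (f c)) (trace-image b c))))

  record Projects (w y : Vertex G) : Set where
    field
      nbr-of-u : adj u w ≡ true
      in-B     : B y ≡ true
      traces   : ∀ v → (adj w v ∧ B v) ≡ trace y v

  projects : ∀ w y → isProjectionOf G φ w y ≡ true → Projects w y
  projects w y p = record
    { nbr-of-u = ∧-trueˡ {adj u w} p
    ; in-B     = ∧-trueˡ {B y} rest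
    ; traces   = λ v → xnor-sound (allFin-sound _ (∧-trueʳ {eqℕ (count (λ v → adj w v ∧ B v)) 4}
                                                    (∧-trueʳ {B y} rest)) v)
    }
    where
    rest : (B y ∧ eqℕ (count (λ v → adj w v ∧ B v)) 4 ∧
              allFin (λ v → not ((adj w v ∧ B v) xor trace y v))) ≡ true
    rest = ∧-trueʳ {adj u w} p

  projection-unique : ∀ w y y' → isProjectionOf G φ w y ≡ true → isProjectionOf G φ w y' ≡ true →
                      y ≡ y'
  projection-unique w y y' p p' = B-separated y y' (Projects.in-B P) (Projects.in-B P')
    (λ v → trans (sym (Projects.traces P v)) (Projects.traces P' v))
    where P = projects w y p
          P' = projects w y' p'

  projection-adjacent : ∀ x w y → B x ≡ true → trace x y ≡ true →
                        isProjectionOf G φ w y ≡ true → (adj x w ∧ adj u w) ≡ true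
  projection-adjacent x w y x∈B y∈Nx p = cong₂ _∧_ (trans (Graph.sym G x w) w~x) (Projects.nbr-of-u P)
    where
    P = projects w y p
    x∈Ny : trace y x ≡ true
    x∈Ny = cong₂ _∧_ (trans (closedAdj-sym G y x) (∧-trueˡ y∈Nx)) x∈B
    w~x : adj w x ≡ true
    w~x = ∧-trueˡ (trans (Projects.traces P x) x∈Ny)

  projSum-bound : ∀ x → B x ≡ true → projSum G φ x ≤ commonNbrs G u x
  projSum-bound x x∈B = double-count (trace x) (isProjectionOf G φ) (λ w → adj x w ∧ adj u w)
    (λ w y y' p p' → projection-unique w y y' (∧-trueʳ {trace x y} p) (∧-trueʳ {trace x y'} p'))
    (λ w y p → projection-adjacent x w y x∈B (∧-trueˡ {trace x y} p) (∧-trueʳ {trace x y} p))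

  neighbour-bound : ∀ y z → B y ≡ true → B z ≡ true → adj y z ≡ true →
                    projMult G φ y ≤ commonNbrs G u z
  neighbour-bound y z y∈B z∈B y~z = begin
    projMult G φ y                                              ≡⟨ sym (if-cong y∈Nz) ⟩
    (if trace z y then projMult G φ y else 0)                   ≤⟨ term≤sum _ y ⟩
    projSum G φ z                                               ≤⟨ projSum-bound z z∈B ⟩
    commonNbrs G u z                                            ∎
    where
    open ≤-Reasoning
    y∈Nz : trace z y ≡ true
    y∈Nz = cong₂ _∧_ (trans (cong (eqFin z y ∨_) (trans (Graph.sym G z y) y~z)) (∨-zeroʳ _)) y∈B

mainTheorem13 : (G : Graph) → Connected G → CopNumberGreaterThan G 3 →
                (u : Vertex G) (i : Fin 7) (φ : PIso G u i) → DegreeConvention G φ →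
                ((x : Vertex G) → inB G φ x ≡ true →
                   projSum G φ x ≤ commonNbrs G u x)
                × ((y : Vertex G) (k : ℕ) → inB G φ y ≡ true → projMult G φ y ≡ k →
                   (z : Vertex G) → inB G φ z ≡ true → Graph.adj G y z ≡ true →
                   k ≤ commonNbrs G u z)
mainTheorem13 G _ _ u i φ _ =
  projSum-bound G φ ,
  λ { y _ y∈B refl z z∈B y~z → neighbour-bound G φ y z y∈B z∈B y~z }
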